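{- Let $S$ be a set of $n$ points in $\mathbb{R}^3$, not all coplanar and no three collinear, and let $k\geqslant1$ be an integer such that some plane contains exactly $n-k$ points of $S$. Let $m$ be the total number of planes determined by $S$. Then \[ m \geqslant 1 + k \binom{n-k}{2}-\binom{k}{2}\left(\frac{n-k}{2}\right). \]
   Context: A plane is determined by $S$ if it contains at least three points of $S$. -}

module Defs where

open import Level using (Level; _⊔_) renaming (suc to lsuc)
open import Data.Nat using (ℕ)
open import Data.Fin using (Fin)
open import Data.Fin.Subset using (Subset; _∈_; ∣_∣)
open import Data.List using (List; length)
open import Data.List.Relation.Unary.All using (All)
open import Data.List.Relation.Unary.Any using (Any)
open import Data.List.Relation.Unary.AllPairs using (AllPairs)
open import Data.Product using (Σ; ∃; _×_; _,_)
open import Relation.Nullary using (¬_)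
open import Relation.Binary.PropositionalEquality using (_≡_)
open import Relation.Binary.Structures using (IsTotalOrder)
open import Algebra.Structures using (IsCommutativeRing)
open import Function.Bundles using (_⇔_)

-- The real numbers, axiomatised as a complete ordered field
-- (unique up to isomorphism).  Equality is propositional equality.
record RealField (ℓ : Level) : Set (lsuc ℓ) where
  infixl 6 _+_
  infixl 7 _*_
  infix 4 _≤_
  field
    ℝ       : Set ℓ
    _+_ _*_ : ℝ → ℝ → ℝ
    -_      : ℝ → ℝ
    0ℝ 1ℝ   : ℝ
    isCommutativeRing : IsCommutativeRing _≡_ _+_ _*_ -_ 0ℝ 1ℝ
    0≢1     : ¬ (0ℝ ≡ 1ℝ)
    inverse : ∀ x → ¬ (x ≡ 0ℝ) → Σ ℝ (λ y → x * y ≡ 1ℝ)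
    _≤_     : ℝ → ℝ → Set ℓ
    isTotalOrder : IsTotalOrder _≡_ _≤_
    +-mono-≤ : ∀ {x y} z → x ≤ y → (x + z) ≤ (y + z)
    *-nonneg : ∀ {x y} → 0ℝ ≤ x → 0ℝ ≤ y → 0ℝ ≤ (x * y)
    complete : (A : ℝ → Set ℓ) → Σ ℝ A →
               Σ ℝ (λ b → ∀ x → A x → x ≤ b) →
               Σ ℝ (λ s → (∀ x → A x → x ≤ s) ×
                          (∀ b → (∀ x → A x → x ≤ b) → s ≤ b))

module Geometry {ℓ : Level} (R : RealField ℓ) where
  open RealField R

  record Point : Set ℓ where
    constructor ⟨_,_,_⟩
    field x y z : ℝ

  0P : Point
  0P = ⟨ 0ℝ , 0ℝ , 0ℝ ⟩

  infixl 6 _⊕_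
  infixr 7 _·ₛ_
  _⊕_ : Point → Point → Point
  ⟨ a , b , c ⟩ ⊕ ⟨ a' , b' , c' ⟩ = ⟨ a + a' , b + b' , c + c' ⟩

  _·ₛ_ : ℝ → Point → Point
  t ·ₛ ⟨ a , b , c ⟩ = ⟨ t * a , t * b , t * c ⟩

  _·_ : Point → Point → ℝ
  ⟨ a , b , c ⟩ · ⟨ a' , b' , c' ⟩ = (a * a' + b * b') + c * c'

  record Plane : Set ℓ where
    field
      normal    : Point
      offset    : ℝ
      normal≢0  : ¬ (normal ≡ 0P)

  _OnPlane_ : Point → Plane → Set ℓ
  p OnPlane P = Plane.normal P · p ≡ Plane.offset P

  SamePlane : Plane → Plane → Set ℓ
  SamePlane P Q = ∀ p → (p OnPlane P) ⇔ (p OnPlane Q)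

  record Line : Set ℓ where
    field
      base    : Point
      dir     : Point
      dir≢0   : ¬ (dir ≡ 0P)

  _OnLine_ : Point → Line → Set ℓ
  p OnLine L = Σ ℝ (λ t → p ≡ Line.base L ⊕ (t ·ₛ Line.dir L))

  Collinear : Point → Point → Point → Set ℓ
  Collinear p q r = Σ Line (λ L → p OnLine L × q OnLine L × r OnLine L)

  module _ {n : ℕ} (S : Fin n → Point) where

    -- S is a set of n points: the labelling is injective
    Distinct : Set ℓ
    Distinct = ∀ i j → S i ≡ S j → i ≡ j

    NotAllCoplanar : Set ℓ
    NotAllCoplanar = ¬ Σ Plane (λ P → ∀ i → S i OnPlane P)

    NoThreeCollinear : Set ℓ
    NoThreeCollinear = ∀ i j k → ¬ (i ≡ j) → ¬ (i ≡ k) → ¬ (j ≡ k) →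
                       ¬ Collinear (S i) (S j) (S k)

    ContainsExactly : Plane → ℕ → Set ℓ
    ContainsExactly P c = Σ (Subset n) (λ T →
      (∣ T ∣ ≡ c) × (∀ i → (i ∈ T) ⇔ (S i OnPlane P)))

    Determined : Plane → Set ℓ
    Determined P = Σ (Fin n) λ i → Σ (Fin n) λ j → Σ (Fin n) λ k →
      ¬ (i ≡ j) × ¬ (i ≡ k) × ¬ (j ≡ k) ×
      S i OnPlane P × S j OnPlane P × S k OnPlane P

    ListsDeterminedPlanes : List Plane → Set ℓ
    ListsDeterminedPlanes Ps =
      All Determined Ps ×
      AllPairs (λ P Q → ¬ SamePlane P Q) Ps ×
      (∀ P → Determined P → Any (SamePlane P) Ps)

module Submission where

-- S: n points in ℝ³, not all coplanar, no three collinear; T: the a = n - k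
-- of them on the plane Π; m: the number of determined planes; α q, β q: the
-- numbers of points of T and outside T on the plane q.  Counting flags (a point
-- and an ordered pair of distinct points on a common plane) in two ways gives
--   k·a(a-1) ≤ Σ β α(α-1)   (a point outside T and two of T span a plane),
--   Σ α β(β-1) ≤ a·k(k-1)   (a point of T and two outside T span one plane).
-- A plane through a point outside T meets Π in a line, so α ≤ 2 when β ≥ 1,
-- and Π has β = 0; hence 2βα(α-1) + 4[q = Π] ≤ 4 + αβ(β-1) for every plane,
-- and summing yields 4 + 2k·a(a-1) ≤ 4m + a·k(k-1), four times the claim (for
-- a ≤ 2 it follows from m ≥ 1, or m ≥ 2 when n = 4).
-- Incidence over ℝ is undecidable, so the proof runs under double negation,
-- which is harmless as the conclusion is a decidable inequality in ℕ.

open import Defs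
open import Level using (Level)

-- ℝ as a commutative ring, with the ring solver over integer coefficients
-- (integer constants are needed so that the solver can cancel terms).
module RealRing {ℓ : Level} (R : RealField ℓ) where
  open import Algebra.Bundles using (CommutativeRing)
  open import Data.Maybe using (Maybe; just; nothing)
  open import Data.Nat as ℕ using (ℕ; zero; suc)
  open import Data.Integer as ℤ using (ℤ; -[1+_]) renaming (+_ to pos)
  import Data.Integer.Properties as ℤ
  import Data.Nat.Properties as ℕ
  open import Data.Sign as Sign using (Sign)
  open import Relation.Nullary using (yes; no)
  open import Relation.Binary.PropositionalEquality
  import Algebra.Solver.Ring.AlmostCommutativeRing as ACR

  open RealField R

  commutativeRing : CommutativeRing ℓ ℓ
  commutativeRing = record { isCommutativeRing = isCommutativeRing }

  open CommutativeRing commutativeRing public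
    using (+-comm; *-comm; +-identityˡ; +-identityʳ; *-identityˡ; zeroˡ; -‿inverseʳ)
  open CommutativeRing commutativeRing using (ring; semiring; +-monoid; +-commutativeSemigroup)
  open import Algebra.Properties.Ring ring
    using (-‿distribˡ-*; -‿distribʳ-*; -‿involutive; -0#≈0#; -‿anti-homo-+)
  open import Algebra.Properties.CommutativeSemigroup +-commutativeSemigroup using (interchange)
  open import Algebra.Properties.Monoid.Mult.TCOptimised +-monoid
    using (×-homo-+) renaming (_×_ to _·ⁿ_)
  open import Algebra.Properties.Semiring.Mult.TCOptimised semiring
    using (×1-homo-*)

  ι : ℕ → ℝ
  ι n = n ·ⁿ 1ℝ

  ⟦_⟧ℤ : ℤ → ℝ
  ⟦ pos n ⟧ℤ    = ι n
  ⟦ -[1+ n ] ⟧ℤ = - ι (suc n)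

  ⊖-homo : ∀ m n → ⟦ m ℤ.⊖ n ⟧ℤ ≡ ι m + - ι n
  ⊖-homo m zero = begin
    ⟦ m ℤ.⊖ 0 ⟧ℤ  ≡⟨ cong ⟦_⟧ℤ (ℤ.⊖-≥ {m} ℕ.z≤n) ⟩
    ι m           ≡⟨ +-identityʳ (ι m) ⟨
    ι m + 0ℝ      ≡⟨ cong (ι m +_) -0#≈0# ⟨
    ι m + - 0ℝ    ∎
    where open ≡-Reasoning
  ⊖-homo zero (suc n) = trans (cong ⟦_⟧ℤ (ℤ.⊖-< {0} {suc n} (ℕ.s≤s ℕ.z≤n))) (sym (+-identityˡ _))
  ⊖-homo (suc m) (suc n) = begin
    ⟦ suc m ℤ.⊖ suc n ⟧ℤ        ≡⟨ cong ⟦_⟧ℤ (ℤ.[1+m]⊖[1+n]≡m⊖n m n) ⟩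
    ⟦ m ℤ.⊖ n ⟧ℤ                ≡⟨ ⊖-homo m n ⟩
    ι m + - ι n                 ≡⟨ +-identityˡ _ ⟨
    0ℝ + (ι m + - ι n)          ≡⟨ cong (_+ (ι m + - ι n)) (-‿inverseʳ 1ℝ) ⟨
    (1ℝ + - 1ℝ) + (ι m + - ι n) ≡⟨ interchange 1ℝ (- 1ℝ) (ι m) (- ι n) ⟩
    (1ℝ + ι m) + (- 1ℝ + - ι n) ≡⟨ cong₂ _+_ (×-homo-+ 1ℝ 1 m) (-‿anti-homo-+ (ι n) 1ℝ) ⟨
    ι (suc m) + - (ι n + 1ℝ)    ≡⟨ cong (λ t → ι (suc m) + - t) (trans (+-comm (ι n) 1ℝ) (sym (×-homo-+ 1ℝ 1 n))) ⟩
    ι (suc m) + - ι (suc n)     ∎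
    where open ≡-Reasoning

  signed : Sign → ℝ → ℝ
  signed Sign.+ x = x
  signed Sign.- x = - x

  ◃-homo : ∀ s n → ⟦ s ℤ.◃ n ⟧ℤ ≡ signed s (ι n)
  ◃-homo Sign.+ zero    = refl
  ◃-homo Sign.- zero    = sym -0#≈0#
  ◃-homo Sign.+ (suc n) = refl
  ◃-homo Sign.- (suc n) = refl

  sign-abs : ∀ i → ⟦ i ⟧ℤ ≡ signed (ℤ.sign i) (ι ℤ.∣ i ∣)
  sign-abs (pos n)   = refl
  sign-abs -[1+ n ]  = refl

  signed-* : ∀ s t x y → signed (s Sign.* t) (x * y) ≡ signed s x * signed t y
  signed-* Sign.+ Sign.+ x y = refl
  signed-* Sign.+ Sign.- x y = -‿distribʳ-* x y
  signed-* Sign.- Sign.+ x y = -‿distribˡ-* x y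
  signed-* Sign.- Sign.- x y = begin
    x * y              ≡⟨ sym (-‿involutive (x * y)) ⟩
    - - (x * y)        ≡⟨ cong -_ (-‿distribʳ-* x y) ⟩
    - (x * - y)        ≡⟨ -‿distribˡ-* x (- y) ⟩
    - x * - y          ∎
    where open ≡-Reasoning

  +-homo : ∀ i j → ⟦ i ℤ.+ j ⟧ℤ ≡ ⟦ i ⟧ℤ + ⟦ j ⟧ℤ
  +-homo (pos m)  (pos n)  = ×-homo-+ 1ℝ m n
  +-homo -[1+ m ] (pos n)  = trans (⊖-homo n (suc m)) (+-comm _ _)
  +-homo (pos m)  -[1+ n ] = ⊖-homo m (suc n)
  +-homo -[1+ m ] -[1+ n ] = begin
    - ι (suc (suc (m ℕ.+ n)))       ≡⟨ cong (λ k → - ι k) (sym (ℕ.+-suc (suc m) n)) ⟩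
    - ι (suc m ℕ.+ suc n)           ≡⟨ cong -_ (×-homo-+ 1ℝ (suc m) (suc n)) ⟩
    - (ι (suc m) + ι (suc n))       ≡⟨ -‿anti-homo-+ _ _ ⟩
    - ι (suc n) + - ι (suc m)       ≡⟨ +-comm _ _ ⟩
    - ι (suc m) + - ι (suc n)       ∎
    where open ≡-Reasoning

  *-homo : ∀ i j → ⟦ i ℤ.* j ⟧ℤ ≡ ⟦ i ⟧ℤ * ⟦ j ⟧ℤ
  *-homo i j = begin
    ⟦ (s Sign.* t) ℤ.◃ (∣i∣ ℕ.* ∣j∣) ⟧ℤ          ≡⟨ ◃-homo (s Sign.* t) (∣i∣ ℕ.* ∣j∣) ⟩
    signed (s Sign.* t) (ι (∣i∣ ℕ.* ∣j∣))        ≡⟨ cong (signed (s Sign.* t)) (×1-homo-* ∣i∣ ∣j∣) ⟩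
    signed (s Sign.* t) (ι ∣i∣ * ι ∣j∣)          ≡⟨ signed-* s t (ι ∣i∣) (ι ∣j∣) ⟩
    signed s (ι ∣i∣) * signed t (ι ∣j∣)          ≡⟨ sym (cong₂ _*_ (sign-abs i) (sign-abs j)) ⟩
    ⟦ i ⟧ℤ * ⟦ j ⟧ℤ                              ∎
    where
    open ≡-Reasoning
    s = ℤ.sign i
    t = ℤ.sign j
    ∣i∣ = ℤ.∣ i ∣
    ∣j∣ = ℤ.∣ j ∣

  neg-homo : ∀ i → ⟦ ℤ.- i ⟧ℤ ≡ - ⟦ i ⟧ℤ
  neg-homo -[1+ n ]      = sym (-‿involutive _)
  neg-homo (pos zero)    = sym -0#≈0#
  neg-homo (pos (suc n)) = refl

  almostCommutativeRing : ACR.AlmostCommutativeRing ℓ ℓ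
  almostCommutativeRing = ACR.fromCommutativeRing commutativeRing

  ℤ-homomorphism : ℤ.+-*-rawRing ACR.-Raw-AlmostCommutative⟶ almostCommutativeRing
  ℤ-homomorphism = record
    { ⟦_⟧ = ⟦_⟧ℤ ; +-homo = +-homo ; *-homo = *-homo ; -‿homo = neg-homo
    ; 0-homo = refl ; 1-homo = refl }

  coefficients≟ : ∀ i j → Maybe (⟦ i ⟧ℤ ≡ ⟦ j ⟧ℤ)
  coefficients≟ i j with i ℤ.≟ j
  ... | yes refl = just refl
  ... | no _     = nothing

  open import Algebra.Solver.Ring ℤ.+-*-rawRing almostCommutativeRing ℤ-homomorphism coefficients≟ public


-- Vector algebra in ℝ³ and planes through three non-collinear points.
module RealGeometry {ℓ : Level} (R : RealField ℓ) where
  open import Data.Nat using (ℕ)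
  open import Data.Integer using () renaming (+_ to pos)
  open import Data.Fin using (#_)
  open import Data.Vec using (_∷_; [])
  open import Data.Product using (Σ; _×_; _,_; proj₁; proj₂)
  open import Data.Sum using (inj₁; inj₂)
  open import Function.Bundles using (_⇔_; mk⇔)
  import Function.Properties.Equivalence as ⇔
  open import Relation.Nullary using (¬_; Dec; yes; no)
  open import Relation.Nullary.Decidable using (¬¬-excluded-middle)
  open import Relation.Nullary.Negation using (¬¬-map)
  open import Relation.Binary.Structures using (IsTotalOrder)
  open import Relation.Binary.PropositionalEquality

  open RealField R
  open Geometry R
  open RealRing R
  open Point
  open IsTotalOrder isTotalOrder using (total; antisym) renaming (trans to ≤-trans)

  *-cancelˡ : ∀ {c a b} → ¬ c ≡ 0ℝ → c * a ≡ c * b → a ≡ b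
  *-cancelˡ {c} {a} {b} c≢0 ca≡cb = begin
    a                  ≡⟨ rescale a ⟩
    c⁻¹ * (c * a)      ≡⟨ cong (c⁻¹ *_) ca≡cb ⟩
    c⁻¹ * (c * b)      ≡⟨ sym (rescale b) ⟩
    b                  ∎
    where
    open ≡-Reasoning
    c⁻¹ = proj₁ (inverse c c≢0)
    rescale : ∀ x → x ≡ c⁻¹ * (c * x)
    rescale x = begin
      x                  ≡⟨ sym (*-identityˡ x) ⟩
      1ℝ * x             ≡⟨ cong (_* x) (sym (proj₂ (inverse c c≢0))) ⟩
      (c * c⁻¹) * x      ≡⟨ solve 3 (λ c d x → (c :* d) :* x := d :* (c :* x)) refl c c⁻¹ x ⟩
      c⁻¹ * (c * x)      ∎

  difference-zero : ∀ {a b} → a + - b ≡ 0ℝ → a ≡ b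
  difference-zero {a} {b} a-b≡0 = begin
    a                  ≡⟨ solve 2 (λ a b → a := (a :+ :- b) :+ b) refl a b ⟩
    (a + - b) + b      ≡⟨ cong (_+ b) a-b≡0 ⟩
    0ℝ + b             ≡⟨ +-identityˡ b ⟩
    b                  ∎
    where open ≡-Reasoning

  -- In a field a square vanishes only at zero (up to double negation, as
  -- equality on ℝ is not decidable).
  square-zero : ∀ t → t * t ≡ 0ℝ → ¬ ¬ t ≡ 0ℝ
  square-zero t t²≡0 t≢0 = 0≢1 (begin
    0ℝ                     ≡⟨ sym (zeroˡ (t⁻¹ * t⁻¹)) ⟩
    0ℝ * (t⁻¹ * t⁻¹)       ≡⟨ cong (_* (t⁻¹ * t⁻¹)) (sym t²≡0) ⟩
    (t * t) * (t⁻¹ * t⁻¹)  ≡⟨ solve 2 (λ t u → (t :* t) :* (u :* u) := (t :* u) :* (t :* u)) refl t t⁻¹ ⟩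
    (t * t⁻¹) * (t * t⁻¹)  ≡⟨ cong₂ _*_ t*t⁻¹≡1 t*t⁻¹≡1 ⟩
    1ℝ * 1ℝ                ≡⟨ *-identityˡ 1ℝ ⟩
    1ℝ                     ∎)
    where
    open ≡-Reasoning
    t⁻¹ = proj₁ (inverse t t≢0)
    t*t⁻¹≡1 = proj₂ (inverse t t≢0)

  square-nonneg : ∀ t → 0ℝ ≤ t * t
  square-nonneg t with total 0ℝ t
  ... | inj₁ 0≤t = *-nonneg 0≤t 0≤t
  ... | inj₂ t≤0 = subst (0ℝ ≤_) (solve 1 (λ t → (:- t) :* (:- t) := t :* t) refl t) (*-nonneg 0≤-t 0≤-t)
    where
    0≤-t : 0ℝ ≤ - t
    0≤-t = subst₂ _≤_ (-‿inverseʳ t) (+-identityˡ (- t)) (+-mono-≤ (- t) t≤0)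

  +-nonneg : ∀ {a b} → 0ℝ ≤ a → 0ℝ ≤ b → 0ℝ ≤ a + b
  +-nonneg {a} {b} 0≤a 0≤b = ≤-trans (subst (0ℝ ≤_) (sym (+-identityˡ b)) 0≤b) (+-mono-≤ b 0≤a)

  nonneg-sum-zero : ∀ {a b} → 0ℝ ≤ a → 0ℝ ≤ b → a + b ≡ 0ℝ → a ≡ 0ℝ
  nonneg-sum-zero {a} {b} 0≤a 0≤b a+b≡0 =
    antisym (subst₂ _≤_ (+-identityˡ a) (trans (+-comm b a) a+b≡0) (+-mono-≤ a 0≤b)) 0≤a

  infixl 6 _−_
  _−_ : Point → Point → Point
  ⟨ a , b , c ⟩ − ⟨ a′ , b′ , c′ ⟩ = ⟨ a + - a′ , b + - b′ , c + - c′ ⟩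

  infixl 7 _×ᶜ_
  _×ᶜ_ : Point → Point → Point
  ⟨ a , b , c ⟩ ×ᶜ ⟨ a′ , b′ , c′ ⟩ = ⟨ b * c′ + - (c * b′) , c * a′ + - (a * c′) , a * b′ + - (b * a′) ⟩

  -- Vector-valued polynomial expressions mirroring the operations on points,
  -- so that identities between points can be checked coordinatewise by the
  -- ring solver.
  record VExpr (n : ℕ) : Set where
    constructor ⟪_,_,_⟫
    field ex ey ez : Polynomial n

  module _ {n : ℕ} where
    infixl 6 _⊕ᵉ_ _−ᵉ_
    infixr 7 _·ₛᵉ_
    infixl 7 _×ᵉ_
    _⊕ᵉ_ _−ᵉ_ _×ᵉ_ : VExpr n → VExpr n → VExpr n
    ⟪ a , b , c ⟫ ⊕ᵉ ⟪ a′ , b′ , c′ ⟫ = ⟪ a :+ a′ , b :+ b′ , c :+ c′ ⟫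
    ⟪ a , b , c ⟫ −ᵉ ⟪ a′ , b′ , c′ ⟫ = ⟪ a :+ :- a′ , b :+ :- b′ , c :+ :- c′ ⟫
    ⟪ a , b , c ⟫ ×ᵉ ⟪ a′ , b′ , c′ ⟫ =
      ⟪ b :* c′ :+ :- (c :* b′) , c :* a′ :+ :- (a :* c′) , a :* b′ :+ :- (b :* a′) ⟫

    _·ₛᵉ_ : Polynomial n → VExpr n → VExpr n
    t ·ₛᵉ ⟪ a , b , c ⟫ = ⟪ t :* a , t :* b , t :* c ⟫

    _·ᵉ_ : VExpr n → VExpr n → Polynomial n
    ⟪ a , b , c ⟫ ·ᵉ ⟪ a′ , b′ , c′ ⟫ = (a :* a′ :+ b :* b′) :+ c :* c′

    0ᵉ : VExpr n
    0ᵉ = ⟪ con (pos 0) , con (pos 0) , con (pos 0) ⟫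

    ⟦_⟧ᵛ : VExpr n → Env n → Point
    ⟦ ⟪ a , b , c ⟫ ⟧ᵛ ρ = ⟨ ⟦ a ⟧ ρ , ⟦ b ⟧ ρ , ⟦ c ⟧ ρ ⟩

  -- Identities are stated in (at most) three points u, v, w and two scalars
  -- s, t; env lists their coordinates as the solver's variables.
  env : Point → Point → Point → ℝ → ℝ → Env 11
  env u v w s t = x u ∷ y u ∷ z u ∷ x v ∷ y v ∷ z v ∷ x w ∷ y w ∷ z w ∷ s ∷ t ∷ []

  uᵉ vᵉ wᵉ : VExpr 11
  uᵉ = ⟪ var (# 0) , var (# 1) , var (# 2) ⟫
  vᵉ = ⟪ var (# 3) , var (# 4) , var (# 5) ⟫
  wᵉ = ⟪ var (# 6) , var (# 7) , var (# 8) ⟫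

  sᵉ tᵉ : Polynomial 11
  sᵉ = var (# 9)
  tᵉ = var (# 10)

  NormalFormsAgree : Env 11 → VExpr 11 → VExpr 11 → Set ℓ
  NormalFormsAgree ρ ⟪ a , b , c ⟫ ⟪ a′ , b′ , c′ ⟫ =
    (⟦ a ⟧↓ ρ ≡ ⟦ a′ ⟧↓ ρ) × (⟦ b ⟧↓ ρ ≡ ⟦ b′ ⟧↓ ρ) × (⟦ c ⟧↓ ρ ≡ ⟦ c′ ⟧↓ ρ)

  vector-identity : ∀ (e e′ : VExpr 11) u v w s t → NormalFormsAgree (env u v w s t) e e′ →
                    ⟦ e ⟧ᵛ (env u v w s t) ≡ ⟦ e′ ⟧ᵛ (env u v w s t)
  vector-identity ⟪ a , b , c ⟫ ⟪ a′ , b′ , c′ ⟫ u v w s t (a≡ , b≡ , c≡) =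
    cong₂ (λ p (q , r) → ⟨ p , q , r ⟩) (prove ρ a a′ a≡) (cong₂ _,_ (prove ρ b b′ b≡) (prove ρ c c′ c≡))
    where ρ = env u v w s t

  scalar-identity : ∀ (e e′ : Polynomial 11) u v w s t → ⟦ e ⟧↓ (env u v w s t) ≡ ⟦ e′ ⟧↓ (env u v w s t) →
                    ⟦ e ⟧ (env u v w s t) ≡ ⟦ e′ ⟧ (env u v w s t)
  scalar-identity e e′ u v w s t = prove (env u v w s t) e e′

  ⊕-identityʳ : ∀ p → p ⊕ 0P ≡ p
  ⊕-identityʳ p = vector-identity (uᵉ ⊕ᵉ 0ᵉ) uᵉ p 0P 0P 0ℝ 0ℝ (refl , refl , refl)

  ·ₛ-zero : ∀ u → 0ℝ ·ₛ u ≡ 0P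
  ·ₛ-zero u = vector-identity (con (pos 0) ·ₛᵉ uᵉ) 0ᵉ u 0P 0P 0ℝ 0ℝ (refl , refl , refl)

  ·ₛ-one : ∀ u → 1ℝ ·ₛ u ≡ u
  ·ₛ-one u = vector-identity (con (pos 1) ·ₛᵉ uᵉ) uᵉ u 0P 0P 0ℝ 0ℝ (refl , refl , refl)

  ·ₛ-assoc : ∀ s t u → s ·ₛ (t ·ₛ u) ≡ (s * t) ·ₛ u
  ·ₛ-assoc s t u = vector-identity (sᵉ ·ₛᵉ (tᵉ ·ₛᵉ uᵉ)) ((sᵉ :* tᵉ) ·ₛᵉ uᵉ) u 0P 0P s t (refl , refl , refl)

  ⊕-difference : ∀ p q → p ⊕ (q − p) ≡ q
  ⊕-difference p q = vector-identity (uᵉ ⊕ᵉ (vᵉ −ᵉ uᵉ)) vᵉ p q 0P 0ℝ 0ℝ (refl , refl , refl)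

  decompose : ∀ u v → (v · v) ·ₛ u ≡ (u · v) ·ₛ v ⊕ (v ×ᶜ u) ×ᶜ v
  decompose u v = vector-identity ((vᵉ ·ᵉ vᵉ) ·ₛᵉ uᵉ) ((uᵉ ·ᵉ vᵉ) ·ₛᵉ vᵉ ⊕ᵉ (vᵉ ×ᵉ uᵉ) ×ᵉ vᵉ)
                    u v 0P 0ℝ 0ℝ (refl , refl , refl)

  ⊕-zero-cross : ∀ w v → w ⊕ 0P ×ᶜ v ≡ w
  ⊕-zero-cross w v = vector-identity (uᵉ ⊕ᵉ 0ᵉ ×ᵉ vᵉ) uᵉ w v 0P 0ℝ 0ℝ (refl , refl , refl)

  double-cross : ∀ a b c → (a ×ᶜ b) ×ᶜ c ≡ (a · c) ·ₛ b ⊕ (- (b · c)) ·ₛ a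
  double-cross a b c = vector-identity ((uᵉ ×ᵉ vᵉ) ×ᵉ wᵉ) ((uᵉ ·ᵉ wᵉ) ·ₛᵉ vᵉ ⊕ᵉ (:- (vᵉ ·ᵉ wᵉ)) ·ₛᵉ uᵉ)
                         a b c 0ℝ 0ℝ (refl , refl , refl)

  vanishing-combination : ∀ a b → 0ℝ ·ₛ b ⊕ (- 0ℝ) ·ₛ a ≡ 0P
  vanishing-combination a b = vector-identity (con (pos 0) ·ₛᵉ vᵉ ⊕ᵉ (:- con (pos 0)) ·ₛᵉ uᵉ) 0ᵉ a b 0P 0ℝ 0ℝ
                                (refl , refl , refl)

  dot-difference : ∀ p q N → (q − p) · N ≡ N · q + - (N · p)
  dot-difference p q N = scalar-identity ((vᵉ −ᵉ uᵉ) ·ᵉ wᵉ) (wᵉ ·ᵉ vᵉ :+ :- (wᵉ ·ᵉ uᵉ)) p q N 0ℝ 0ℝ refl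

  ·ₛ-dot : ∀ l w v → (l ·ₛ w) · v ≡ l * (w · v)
  ·ₛ-dot l w v = scalar-identity ((sᵉ ·ₛᵉ uᵉ) ·ᵉ vᵉ) (sᵉ :* (uᵉ ·ᵉ vᵉ)) w v 0P l 0ℝ refl

  dot-self-nonzero : ∀ v → ¬ v ≡ 0P → ¬ v · v ≡ 0ℝ
  dot-self-nonzero v v≢0 v·v≡0 =
    square-zero (x v) (nonneg-sum-zero (square-nonneg (x v)) (square-nonneg (y v)) xy≡0) λ x≡0 →
    square-zero (y v) (nonneg-sum-zero (square-nonneg (y v)) (square-nonneg (x v)) (trans (+-comm _ _) xy≡0)) λ y≡0 →
    square-zero (z v) z≡0 λ z≡0 →
    v≢0 (cong₂ (λ a (b , c) → ⟨ a , b , c ⟩) x≡0 (cong₂ _,_ y≡0 z≡0))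
    where
    xy = x v * x v + y v * y v
    z≡0 : z v * z v ≡ 0ℝ
    z≡0 = nonneg-sum-zero (square-nonneg (z v)) (+-nonneg (square-nonneg (x v)) (square-nonneg (y v)))
                          (trans (+-comm _ _) v·v≡0)
    xy≡0 : xy ≡ 0ℝ
    xy≡0 = nonneg-sum-zero (+-nonneg (square-nonneg (x v)) (square-nonneg (y v))) (square-nonneg (z v)) v·v≡0

  parallel : ∀ u v → v ×ᶜ u ≡ 0P → ¬ v ≡ 0P → Σ ℝ λ t → u ≡ t ·ₛ v
  parallel u v v×u≡0 v≢0 = c⁻¹ * (u · v) , (begin
    u                                          ≡⟨ sym (·ₛ-one u) ⟩
    1ℝ ·ₛ u                                    ≡⟨ cong (_·ₛ u) (sym (trans (*-comm c⁻¹ c) c*c⁻¹≡1)) ⟩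
    (c⁻¹ * c) ·ₛ u                             ≡⟨ sym (·ₛ-assoc c⁻¹ c u) ⟩
    c⁻¹ ·ₛ (c ·ₛ u)                            ≡⟨ cong (c⁻¹ ·ₛ_) (decompose u v) ⟩
    c⁻¹ ·ₛ ((u · v) ·ₛ v ⊕ (v ×ᶜ u) ×ᶜ v)      ≡⟨ cong (λ w → c⁻¹ ·ₛ ((u · v) ·ₛ v ⊕ w ×ᶜ v)) v×u≡0 ⟩
    c⁻¹ ·ₛ ((u · v) ·ₛ v ⊕ 0P ×ᶜ v)            ≡⟨ cong (c⁻¹ ·ₛ_) (⊕-zero-cross ((u · v) ·ₛ v) v) ⟩
    c⁻¹ ·ₛ ((u · v) ·ₛ v)                      ≡⟨ ·ₛ-assoc c⁻¹ (u · v) v ⟩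
    (c⁻¹ * (u · v)) ·ₛ v                       ∎)
    where
    open ≡-Reasoning
    c = v · v
    c⁻¹ = proj₁ (inverse c (dot-self-nonzero v v≢0))
    c*c⁻¹≡1 = proj₂ (inverse c (dot-self-nonzero v v≢0))

  normal-of : Point → Point → Point → Point
  normal-of p q r = (q − p) ×ᶜ (r − p)

  collinear : ∀ p q r → ¬ p ≡ q → normal-of p q r ≡ 0P → Collinear p q r
  collinear p q r p≢q normal≡0 =
    L , (0ℝ , sym (trans (cong (p ⊕_) (·ₛ-zero d)) (⊕-identityʳ p)))
      , (1ℝ , sym (trans (cong (p ⊕_) (·ₛ-one d)) (⊕-difference p q)))
      , (t , trans (sym (⊕-difference p r)) (cong (p ⊕_) r-p≡td))
    where
    d = q − p
    d≢0 : ¬ d ≡ 0P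
    d≢0 d≡0 = p≢q (sym (begin
      q          ≡⟨ sym (⊕-difference p q) ⟩
      p ⊕ d      ≡⟨ cong (p ⊕_) d≡0 ⟩
      p ⊕ 0P     ≡⟨ ⊕-identityʳ p ⟩
      p          ∎))
      where open ≡-Reasoning
    L : Line
    L = record { base = p ; dir = d ; dir≢0 = d≢0 }
    t = proj₁ (parallel (r − p) d normal≡0 d≢0)
    r-p≡td = proj₂ (parallel (r − p) d normal≡0 d≢0)

  plane-through : ∀ {p q r} → ¬ normal-of p q r ≡ 0P →
                  Σ Plane λ P → p OnPlane P × q OnPlane P × r OnPlane P
  plane-through {p} {q} {r} N≢0 =
    record { normal = N ; offset = N · p ; normal≢0 = N≢0 } , refl , q-on , r-on
    where
    N = normal-of p q r
    -- The triple products [q - p, r - p, q - p] and [q - p, r - p, r - p] vanish.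
    Nᵉ : VExpr 11
    Nᵉ = (vᵉ −ᵉ uᵉ) ×ᵉ (wᵉ −ᵉ uᵉ)
    q-on : N · q ≡ N · p
    q-on = scalar-identity (Nᵉ ·ᵉ vᵉ) (Nᵉ ·ᵉ uᵉ) p q r 0ℝ 0ℝ refl
    r-on : N · r ≡ N · p
    r-on = scalar-identity (Nᵉ ·ᵉ wᵉ) (Nᵉ ·ᵉ uᵉ) p q r 0ℝ 0ℝ refl

  -- The normal vector of any plane through non-collinear p, q, r is a
  -- nonzero multiple of normal-of p q r, being orthogonal to q - p and r - p.
  normal-multiple : ∀ {p q r} (P : Plane) → ¬ normal-of p q r ≡ 0P →
                    p OnPlane P → q OnPlane P → r OnPlane P →
                    Σ ℝ λ l → ¬ l ≡ 0ℝ × Plane.normal P ≡ l ·ₛ normal-of p q r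
  normal-multiple {p} {q} {r} P M≢0 p-on q-on r-on = l , l≢0 , N≡lM
    where
    open ≡-Reasoning
    N = Plane.normal P
    M = normal-of p q r
    orthogonal : ∀ {a} → a OnPlane P → (a − p) · N ≡ 0ℝ
    orthogonal {a} a-on = begin
      (a − p) · N        ≡⟨ dot-difference p a N ⟩
      N · a + - (N · p)  ≡⟨ cong₂ (λ s t → s + - t) a-on p-on ⟩
      _ + - _            ≡⟨ -‿inverseʳ (Plane.offset P) ⟩
      0ℝ                 ∎
    M×N≡0 : M ×ᶜ N ≡ 0P
    M×N≡0 = begin
      M ×ᶜ N
        ≡⟨ double-cross (q − p) (r − p) N ⟩
      ((q − p) · N) ·ₛ (r − p) ⊕ (- ((r − p) · N)) ·ₛ (q − p)
        ≡⟨ cong₂ (λ s t → s ·ₛ (r − p) ⊕ (- t) ·ₛ (q − p)) (orthogonal q-on) (orthogonal r-on) ⟩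
      0ℝ ·ₛ (r − p) ⊕ (- 0ℝ) ·ₛ (q − p)
        ≡⟨ vanishing-combination (q − p) (r − p) ⟩
      0P ∎
    l = proj₁ (parallel N M M×N≡0 M≢0)
    N≡lM = proj₂ (parallel N M M×N≡0 M≢0)
    l≢0 : ¬ l ≡ 0ℝ
    l≢0 l≡0 = Plane.normal≢0 P (trans N≡lM (trans (cong (_·ₛ M) l≡0) (·ₛ-zero M)))

  plane-equation : ∀ {p q r} (P : Plane) → ¬ normal-of p q r ≡ 0P →
                   p OnPlane P → q OnPlane P → r OnPlane P →
                   ∀ v → v OnPlane P ⇔ (normal-of p q r · v ≡ normal-of p q r · p)
  plane-equation {p} {q} {r} P M≢0 p-on q-on r-on v = mk⇔ to from
    where
    open ≡-Reasoning
    N = Plane.normal P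
    M = normal-of p q r
    l = proj₁ (normal-multiple P M≢0 p-on q-on r-on)
    l≢0 = proj₁ (proj₂ (normal-multiple P M≢0 p-on q-on r-on))
    N≡lM = proj₂ (proj₂ (normal-multiple P M≢0 p-on q-on r-on))
    N·≡ : ∀ a → N · a ≡ l * (M · a)
    N·≡ a = trans (cong (_· a) N≡lM) (·ₛ-dot l M a)
    to : v OnPlane P → M · v ≡ M · p
    to v-on = *-cancelˡ l≢0 (begin
      l * (M · v)  ≡⟨ N·≡ v ⟨
      N · v        ≡⟨ trans v-on (sym p-on) ⟩
      N · p        ≡⟨ N·≡ p ⟩
      l * (M · p)  ∎)
    from : M · v ≡ M · p → v OnPlane P
    from M·v≡M·p = begin
      N · v        ≡⟨ N·≡ v ⟩
      l * (M · v)  ≡⟨ cong (l *_) M·v≡M·p ⟩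
      l * (M · p)  ≡⟨ N·≡ p ⟨
      N · p        ≡⟨ p-on ⟩
      Plane.offset P ∎

  same-plane : ∀ {p q r} (P Q : Plane) → ¬ normal-of p q r ≡ 0P →
               p OnPlane P → q OnPlane P → r OnPlane P →
               p OnPlane Q → q OnPlane Q → r OnPlane Q → SamePlane P Q
  same-plane P Q M≢0 pP qP rP pQ qQ rQ v =
    ⇔.trans (plane-equation P M≢0 pP qP rP v) (⇔.sym (plane-equation Q M≢0 pQ qQ rQ v))

  -- Any two points lie on a common plane.  Constructively this holds only up
  -- to double negation: which normal vector works depends on whether the
  -- points have the same y-coordinate.
  plane-through-two : ∀ p q → ¬ ¬ (Σ Plane λ P → p OnPlane P × q OnPlane P)
  plane-through-two p q = ¬¬-map by-cases (¬¬-excluded-middle {A = y p ≡ y q})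
    where
    by-cases : Dec (y p ≡ y q) → Σ Plane λ P → p OnPlane P × q OnPlane P
    by-cases (yes yp≡yq) = horizontal , e₂-dot p , trans (e₂-dot q) (sym yp≡yq)
      where
      e₂ : Point
      e₂ = ⟨ 0ℝ , 1ℝ , 0ℝ ⟩
      e₂-dot : ∀ v → e₂ · v ≡ y v
      e₂-dot v = scalar-identity (⟪ con (pos 0) , con (pos 1) , con (pos 0) ⟫ ·ᵉ uᵉ) (var (# 1)) v 0P 0P 0ℝ 0ℝ refl
      horizontal : Plane
      horizontal = record { normal = e₂ ; offset = y p ; normal≢0 = λ e₂≡0 → 0≢1 (sym (cong y e₂≡0)) }
    by-cases (no yp≢yq) = vertical , refl , q-on
      where
      N : Point
      N = ⟨ y q + - y p , x p + - x q , 0ℝ ⟩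
      Nᵉ : VExpr 11
      Nᵉ = ⟪ var (# 4) :+ :- var (# 1) , var (# 0) :+ :- var (# 3) , con (pos 0) ⟫
      q-on : N · q ≡ N · p
      q-on = scalar-identity (Nᵉ ·ᵉ vᵉ) (Nᵉ ·ᵉ uᵉ) p q 0P 0ℝ 0ℝ refl
      vertical : Plane
      vertical = record { normal = N ; offset = N · p
                        ; normal≢0 = λ N≡0 → yp≢yq (sym (difference-zero (cong x N≡0))) }



open import Data.Nat using (ℕ; zero; suc; _+_; _*_; _∸_; _≤_; z≤n; s≤s; s≤s⁻¹; _≤?_)
open import Data.Nat.Properties hiding (_≟_; suc-injective)
open import Data.Nat.Tactic.RingSolver using (solve-∀)
open import Data.Nat.Combinatorics using (_C_; nC1≡n; nCk+nC[k+1]≡[n+1]C[k+1])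
open import Data.Fin using (Fin; zero; suc; _≟_)
open import Data.Fin.Properties using (suc-injective)
open import Data.Fin.Patterns using (0F; 1F; 2F; 3F)
open import Data.Fin.Subset using (Subset; _∈_; ∣_∣; inside; outside)
open import Data.Fin.Subset.Properties using (_∈?_; drop-there)
open import Data.Vec using (_∷_; [])
open import Data.Vec.Base using (there)
open import Data.List using (List; length; lookup)
open import Data.List.Relation.Unary.All as All using (All)
open import Data.List.Relation.Unary.Any as Any using (Any)
open import Data.List.Relation.Unary.Any.Properties using (lookup-index)
open import Data.List.Relation.Unary.AllPairs using (AllPairs; _∷_)
open import Data.List.Membership.Propositional.Properties using (∈-lookup)
open import Data.Product using (Σ; _×_; _,_; proj₁; proj₂)
open import Data.Empty using (⊥; ⊥-elim)
open import Function using (_∘_)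
open import Function.Bundles using (_⇔_; Equivalence)
import Function.Properties.Equivalence as ⇔
open import Relation.Nullary using (¬_; Dec; yes; no; ¬?; _×-dec_)
open import Relation.Nullary.Decidable using (decidable-stable; ¬¬-excluded-middle)
open import Relation.Nullary.Negation using (contradiction; ¬¬-map)
open import Relation.Unary using (Pred; Decidable)
open import Relation.Binary.PropositionalEquality
open import Algebra.Properties.Semiring.Sum +-*-semiring
  using (sum; ∑-comm; ∑-distrib-+; *-distribˡ-sum; *-distribʳ-sum; sum-cong-≗)

private
  variable
    ℓ₁ ℓ₂ : Level
    A B : Set ℓ₁
    n : ℕ

𝟙 : Dec A → ℕ
𝟙 (yes _) = 1
𝟙 (no _)  = 0

𝟙-≤1 : (A? : Dec A) → 𝟙 A? ≤ 1
𝟙-≤1 (yes _) = s≤s z≤n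
𝟙-≤1 (no _)  = z≤n

𝟙-yes : (A? : Dec A) → A → 𝟙 A? ≡ 1
𝟙-yes (yes _) _ = refl
𝟙-yes (no ¬a) a = contradiction a ¬a

𝟙-no : (A? : Dec A) → ¬ A → 𝟙 A? ≡ 0
𝟙-no (yes a) ¬a = contradiction a ¬a
𝟙-no (no _)  _  = refl

𝟙-true : (A? : Dec A) → 1 ≤ 𝟙 A? → A
𝟙-true (yes a) _ = a

𝟙-cong : (A? : Dec A) (B? : Dec B) → (A → B) → (B → A) → 𝟙 A? ≡ 𝟙 B?
𝟙-cong (yes _) (yes _) _ _   = refl
𝟙-cong (yes a) (no ¬b) f _   = contradiction (f a) ¬b
𝟙-cong (no ¬a) (yes b) _ g   = contradiction (g b) ¬a
𝟙-cong (no _)  (no _)  _ _   = refl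

𝟙-× : (A? : Dec A) (B? : Dec B) → 𝟙 (A? ×-dec B?) ≡ 𝟙 A? * 𝟙 B?
𝟙-× (yes _) (yes _) = refl
𝟙-× (yes _) (no _)  = refl
𝟙-× (no _)  _       = refl

𝟙-split : (A? : Dec A) (B? : Dec B) → 𝟙 B? ≡ 𝟙 (A? ×-dec B?) + 𝟙 (¬? A? ×-dec B?)
𝟙-split (yes _) (yes _) = refl
𝟙-split (yes _) (no _)  = refl
𝟙-split (no _)  (yes _) = refl
𝟙-split (no _)  (no _)  = refl

sum-mono : {f g : Fin n → ℕ} → (∀ i → f i ≤ g i) → sum f ≤ sum g
sum-mono {zero}  f≤g = z≤n
sum-mono {suc n} f≤g = +-mono-≤ (f≤g zero) (sum-mono (f≤g ∘ suc))

sum-const : ∀ n c → sum {n} (λ _ → c) ≡ n * c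
sum-const zero    c = refl
sum-const (suc n) c = cong (c +_) (sum-const n c)

count : {P : Pred (Fin n) ℓ₁} → Decidable P → ℕ
count P? = sum (λ i → 𝟙 (P? i))

module _ {P : Pred (Fin n) ℓ₁} (P? : Decidable P) where

  count-cong : {Q : Pred (Fin n) ℓ₂} (Q? : Decidable Q) →
               (∀ {i} → P i → Q i) → (∀ {i} → Q i → P i) → count P? ≡ count Q?
  count-cong Q? P⇒Q Q⇒P = sum-cong-≗ (λ i → 𝟙-cong (P? i) (Q? i) P⇒Q Q⇒P)

  count-none : (∀ i → ¬ P i) → count P? ≡ 0
  count-none ¬P = trans (sum-cong-≗ (λ i → 𝟙-no (P? i) (¬P i))) (trans (sum-const n 0) (*-zeroʳ n))

count-witness : {P : Pred (Fin n) ℓ₁} (P? : Decidable P) → 1 ≤ count P? → Σ (Fin n) P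
count-witness {n = suc n} P? c with P? zero
... | yes p = zero , p
... | no _  = let i , p = count-witness (P? ∘ suc) c in suc i , p

count-at : {P : Pred (Fin n) ℓ₁} (P? : Decidable P) (i : Fin n) →
           count (λ j → i ≟ j ×-dec P? j) ≡ 𝟙 (P? i)
count-at {suc n} P? zero = trans
  (cong₂ _+_ (𝟙-cong (zero ≟ zero ×-dec P? zero) (P? zero) proj₂ (refl ,_))
             (count-none (λ j → zero ≟ suc j ×-dec P? (suc j)) (λ j ())))
  (+-identityʳ _)
count-at {suc n} P? (suc i) = begin
  𝟙 (suc i ≟ zero ×-dec P? zero) + count (λ j → suc i ≟ suc j ×-dec P? (suc j))
    ≡⟨ cong₂ _+_ (𝟙-no (suc i ≟ zero ×-dec P? zero) (λ ()))
                 (count-cong (λ j → suc i ≟ suc j ×-dec P? (suc j)) (λ j → i ≟ j ×-dec P? (suc j))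
                     (λ (e , p) → suc-injective e , p) (λ (e , p) → cong suc e , p)) ⟩
  count (λ j → i ≟ j ×-dec P? (suc j))
    ≡⟨ count-at (P? ∘ suc) i ⟩
  𝟙 (P? (suc i)) ∎
  where open ≡-Reasoning

module _ {P : Pred (Fin n) ℓ₁} (P? : Decidable P) where

  others : (i : Fin n) → Decidable (λ j → ¬ i ≡ j × P j)
  others i j = ¬? (i ≟ j) ×-dec P? j

  count-split : ∀ i → count P? ≡ 𝟙 (P? i) + count (others i)
  count-split i = begin
    count P?
      ≡⟨ sum-cong-≗ (λ j → 𝟙-split (i ≟ j) (P? j)) ⟩
    sum (λ j → 𝟙 (i ≟ j ×-dec P? j) + 𝟙 (others i j))
      ≡⟨ ∑-distrib-+ (λ j → 𝟙 (i ≟ j ×-dec P? j)) (λ j → 𝟙 (others i j)) ⟩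
    count (λ j → i ≟ j ×-dec P? j) + count (others i)
      ≡⟨ cong (_+ count (others i)) (count-at P? i) ⟩
    𝟙 (P? i) + count (others i) ∎
    where open ≡-Reasoning

  count-others : ∀ {i} → P i → count P? ≡ suc (count (others i))
  count-others {i} p = trans (count-split i) (cong (_+ count (others i)) (𝟙-yes (P? i) p))

  count-positive : ∀ {i} → P i → 1 ≤ count P?
  count-positive p = subst (1 ≤_) (sym (count-others p)) (s≤s z≤n)

  two-witnesses : 2 ≤ count P? → Σ (Fin n) λ i → Σ (Fin n) λ j → ¬ i ≡ j × P i × P j
  two-witnesses c≥2 =
    let i , pᵢ = count-witness P? (≤-trans (s≤s z≤n) c≥2)
        j , i≢j , pⱼ = count-witness (others i) (s≤s⁻¹ (subst (2 ≤_) (count-others pᵢ) c≥2))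
    in i , j , i≢j , pᵢ , pⱼ

module _ {P : Pred (Fin n) ℓ₁} (P? : Decidable P) where

  three-witnesses : 3 ≤ count P? →
    Σ (Fin n) λ i → Σ (Fin n) λ j → Σ (Fin n) λ k →
      ¬ i ≡ j × ¬ i ≡ k × ¬ j ≡ k × P i × P j × P k
  three-witnesses c≥3 =
    let i , pᵢ = count-witness P? (≤-trans (s≤s z≤n) c≥3)
        j , k , j≢k , (i≢j , pⱼ) , (i≢k , pₖ) =
          two-witnesses (others P? i) (s≤s⁻¹ (subst (3 ≤_) (count-others P? pᵢ) c≥3))
    in i , j , k , i≢j , i≢k , j≢k , pᵢ , pⱼ , pₖ

  count-≤1 : (∀ {i j} → P i → P j → i ≡ j) → count P? ≤ 1
  count-≤1 unique with 2 ≤? count P?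
  ... | no c≱2 = s≤s⁻¹ (≰⇒> c≱2)
  ... | yes c≥2 = let i , j , i≢j , pᵢ , pⱼ = two-witnesses P? c≥2 in
                  contradiction (unique pᵢ pⱼ) i≢j

  count-complement : count P? + count (¬? ∘ P?) ≡ n
  count-complement = begin
    count P? + count (¬? ∘ P?)                   ≡⟨ ∑-distrib-+ (λ i → 𝟙 (P? i)) (λ i → 𝟙 (¬? (P? i))) ⟨
    sum (λ i → 𝟙 (P? i) + 𝟙 (¬? (P? i)))         ≡⟨ sum-cong-≗ (λ i → 𝟙-dichotomy (P? i)) ⟩
    sum {n} (λ _ → 1)                            ≡⟨ sum-const n 1 ⟩
    n * 1                                        ≡⟨ *-identityʳ n ⟩
    n                                            ∎
    where
    open ≡-Reasoning
    𝟙-dichotomy : (A? : Dec A) → 𝟙 A? + 𝟙 (¬? A?) ≡ 1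
    𝟙-dichotomy (yes _) = refl
    𝟙-dichotomy (no _)  = refl

  DistinctPair : Fin n → Fin n → Set ℓ₁
  DistinctPair i j = P i × ¬ i ≡ j × P j

  distinctPair? : ∀ i j → Dec (DistinctPair i j)
  distinctPair? i j = P? i ×-dec others P? i j

  count-pairs : sum (λ i → count (distinctPair? i)) ≡ count P? * (count P? ∸ 1)
  count-pairs = begin
    sum (λ i → count (distinctPair? i))
      ≡⟨ sum-cong-≗ (λ i → trans (sum-cong-≗ (λ j → 𝟙-× (P? i) (others P? i j)))
                                  (sym (*-distribˡ-sum (𝟙 (P? i)) (λ j → 𝟙 (others P? i j))))) ⟩
    sum (λ i → 𝟙 (P? i) * count (others P? i))
      ≡⟨ sum-cong-≗ pair-term ⟩
    sum (λ i → 𝟙 (P? i) * (count P? ∸ 1))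
      ≡⟨ *-distribʳ-sum (count P? ∸ 1) (λ i → 𝟙 (P? i)) ⟨
    count P? * (count P? ∸ 1) ∎
    where
    open ≡-Reasoning
    pair-term : ∀ i → 𝟙 (P? i) * count (others P? i) ≡ 𝟙 (P? i) * (count P? ∸ 1)
    pair-term i with P? i
    ... | yes p = cong (_+ 0) (sym (cong (_∸ 1) (count-others P? p)))
    ... | no _  = refl

∑³ : (Fin n → Fin n → Fin n → ℕ) → ℕ
∑³ f = sum λ x → sum λ y → sum λ z → f x y z

∑³-mono : {f g : Fin n → Fin n → Fin n → ℕ} → (∀ x y z → f x y z ≤ g x y z) → ∑³ f ≤ ∑³ g
∑³-mono f≤g = sum-mono λ x → sum-mono λ y → sum-mono λ z → f≤g x y z

∑³-cong : {f g : Fin n → Fin n → Fin n → ℕ} → (∀ x y z → f x y z ≡ g x y z) → ∑³ f ≡ ∑³ g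
∑³-cong f≡g = sum-cong-≗ λ x → sum-cong-≗ λ y → sum-cong-≗ λ z → f≡g x y z

∑-∑³-comm : ∀ {m} (f : Fin m → Fin n → Fin n → Fin n → ℕ) →
            sum (λ q → ∑³ (f q)) ≡ ∑³ (λ x y z → sum λ q → f q x y z)
∑-∑³-comm f =
  trans (∑-comm (λ q x → sum λ y → sum λ z → f q x y z))
        (sum-cong-≗ λ x → trans (∑-comm (λ q y → sum λ z → f q x y z))
                                (sum-cong-≗ λ y → ∑-comm (λ q z → f q x y z)))

count-triples : {X : Pred (Fin n) ℓ₁} {Y : Pred (Fin n) ℓ₂} (X? : Decidable X) (Y? : Decidable Y) →
                ∑³ (λ x y z → 𝟙 (X? x ×-dec distinctPair? Y? y z)) ≡ count X? * (count Y? * (count Y? ∸ 1))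
count-triples X? Y? = begin
  ∑³ (λ x y z → 𝟙 (X? x ×-dec distinctPair? Y? y z))
    ≡⟨ ∑³-cong (λ x y z → 𝟙-× (X? x) (distinctPair? Y? y z)) ⟩
  ∑³ (λ x y z → 𝟙 (X? x) * 𝟙 (distinctPair? Y? y z))
    ≡⟨ sum-cong-≗ (λ x → pull-out (𝟙 (X? x))) ⟩
  sum (λ x → 𝟙 (X? x) * pairs)
    ≡⟨ *-distribʳ-sum pairs (λ x → 𝟙 (X? x)) ⟨
  count X? * pairs
    ≡⟨ cong (count X? *_) (count-pairs Y?) ⟩
  count X? * (count Y? * (count Y? ∸ 1)) ∎
  where
  open ≡-Reasoning
  pairs = sum (λ y → count (distinctPair? Y? y))
  pull-out : ∀ c → sum (λ y → sum λ z → c * 𝟙 (distinctPair? Y? y z)) ≡ c * pairs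
  pull-out c = sym (trans (*-distribˡ-sum c (λ y → count (distinctPair? Y? y)))
                          (sum-cong-≗ λ y → *-distribˡ-sum c (λ z → 𝟙 (distinctPair? Y? y z))))

module Flags {m ℓ} {X : Pred (Fin n) ℓ₁} {Y : Pred (Fin n) ℓ₂} (X? : Decidable X) (Y? : Decidable Y)
             {On : Fin n → Fin m → Set ℓ} (On? : ∀ i q → Dec (On i q)) where

  X-on : (q : Fin m) → Decidable (λ x → X x × On x q)
  X-on q x = X? x ×-dec On? x q
  Y-on : (q : Fin m) → Decidable (λ y → Y y × On y q)
  Y-on q y = Y? y ×-dec On? y q

  flags : Fin m → ℕ
  flags q = ∑³ (λ x y z → 𝟙 (X-on q x ×-dec distinctPair? (Y-on q) y z))

  flags-on-block : ∀ q → flags q ≡ count (X-on q) * (count (Y-on q) * (count (Y-on q) ∸ 1))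
  flags-on-block q = count-triples (X-on q) (Y-on q)

  through : (x y z : Fin n) → Decidable (λ q → On x q × On y q × On z q)
  through x y z q = On? x q ×-dec On? y q ×-dec On? z q

  configurations : Fin n → Fin n → Fin n → ℕ
  configurations x y z = 𝟙 (X? x ×-dec distinctPair? Y? y z)

  -- Summing over the blocks first counts every configuration once per
  -- block through it.
  all-flags : sum flags ≡ ∑³ (λ x y z → configurations x y z * count (through x y z))
  all-flags = trans (∑-∑³-comm {m = m} (λ q x y z → 𝟙 (X-on q x ×-dec distinctPair? (Y-on q) y z))) (∑³-cong λ x y z → begin
    sum (λ q → 𝟙 (X-on q x ×-dec distinctPair? (Y-on q) y z))
      ≡⟨ sum-cong-≗ (λ q → trans (𝟙-cong (X-on q x ×-dec distinctPair? (Y-on q) y z)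
                                           ((X? x ×-dec distinctPair? Y? y z) ×-dec through x y z q)
                                           regroup ungroup)
                                  (𝟙-× (X? x ×-dec distinctPair? Y? y z) (through x y z q))) ⟩
    sum (λ q → configurations x y z * 𝟙 (through x y z q))
      ≡⟨ *-distribˡ-sum (configurations x y z) (λ q → 𝟙 (through x y z q)) ⟨
    configurations x y z * count (through x y z) ∎)
    where
    open ≡-Reasoning
    regroup : ∀ {x y z q} → (X x × On x q) × (Y y × On y q) × ¬ y ≡ z × (Y z × On z q) →
              (X x × Y y × ¬ y ≡ z × Y z) × On x q × On y q × On z q
    regroup ((xX , xq) , (yY , yq) , y≢z , (zY , zq)) = (xX , yY , y≢z , zY) , xq , yq , zq
    ungroup : ∀ {x y z q} → (X x × Y y × ¬ y ≡ z × Y z) × On x q × On y q × On z q →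
              (X x × On x q) × (Y y × On y q) × ¬ y ≡ z × (Y z × On z q)
    ungroup ((xX , yY , y≢z , zY) , xq , yq , zq) = (xX , xq) , (yY , yq) , y≢z , (zY , zq)

  flags-≥ : (∀ {x y z} → X x → Y y → Y z → ¬ y ≡ z → Σ (Fin m) λ q → On x q × On y q × On z q) →
            count X? * (count Y? * (count Y? ∸ 1)) ≤ sum flags
  flags-≥ covered = begin
    count X? * (count Y? * (count Y? ∸ 1))  ≡⟨ count-triples X? Y? ⟨
    ∑³ configurations                         ≤⟨ ∑³-mono term ⟩
    ∑³ (λ x y z → configurations x y z * count (through x y z)) ≡⟨ all-flags ⟨
    sum flags ∎
    where
    open ≤-Reasoning
    term : ∀ x y z → configurations x y z ≤ configurations x y z * count (through x y z)
    term x y z with X? x ×-dec distinctPair? Y? y z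
    ... | no _ = z≤n
    ... | yes (xX , yY , y≢z , zY) =
      let q , t = covered xX yY zY y≢z in
      ≤-trans (count-positive (through x y z) t) (≤-reflexive (sym (+-identityʳ _)))

  flags-≤ : (∀ {x y z q q′} → X x → Y y → Y z → ¬ y ≡ z →
               On x q × On y q × On z q → On x q′ × On y q′ × On z q′ → q ≡ q′) →
            sum flags ≤ count X? * (count Y? * (count Y? ∸ 1))
  flags-≤ unique = begin
    sum flags                                                  ≡⟨ all-flags ⟩
    ∑³ (λ x y z → configurations x y z * count (through x y z)) ≤⟨ ∑³-mono term ⟩
    ∑³ configurations                                          ≡⟨ count-triples X? Y? ⟩
    count X? * (count Y? * (count Y? ∸ 1)) ∎
    where
    open ≤-Reasoning
    term : ∀ x y z → configurations x y z * count (through x y z) ≤ configurations x y z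
    term x y z with X? x ×-dec distinctPair? Y? y z
    ... | no _ = z≤n
    ... | yes (xX , yY , y≢z , zY) =
      ≤-trans (≤-reflexive (+-identityʳ _)) (count-≤1 (through x y z) (unique xX yY zY y≢z))

block-inequality : ∀ α β e → e ≤ 1 → (1 ≤ β → α ≤ 2) → (1 ≤ e → β ≡ 0) →
                   2 * (β * (α * (α ∸ 1))) + 4 * e ≤ 4 + α * (β * (β ∸ 1))
block-inequality α zero    e       e≤1 _   _     = ≤-trans (*-monoʳ-≤ 4 e≤1) (m≤m+n 4 _)
block-inequality α (suc β) (suc e) _   _   pure  = contradiction (pure (s≤s z≤n)) (λ ())
block-inequality α (suc β) zero    _   α≤2 _     =
  subst (_≤ 4 + α * (suc β * β)) (sym (+-identityʳ _)) (few α β (α≤2 (s≤s z≤n)))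
  where
  few : ∀ α β → α ≤ 2 → 2 * (suc β * (α * (α ∸ 1))) ≤ 4 + α * (suc β * β)
  few 0 β _ = ≤-trans (≤-reflexive (cong (2 *_) (*-zeroʳ (suc β)))) z≤n
  few 1 β _ = ≤-trans (≤-reflexive (cong (2 *_) (*-zeroʳ (suc β)))) z≤n
  few 2 zero    _ = ≤-refl
  few 2 (suc γ) _ = ≤-trans (m≤m+n _ (2 * γ + 2 * (γ * γ))) (≤-reflexive (expand γ))
    where
    expand : ∀ γ → 2 * ((2 + γ) * 2) + (2 * γ + 2 * (γ * γ)) ≡ 4 + 2 * ((2 + γ) * (1 + γ))
    expand = solve-∀
  few (suc (suc (suc α))) β (s≤s (s≤s ()))

count-singleton : (i : Fin n) → count (i ≟_) ≡ 1
count-singleton i = trans (count-others (i ≟_) refl)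
                          (cong suc (count-none (others (i ≟_) i) (λ j (i≢j , i≡j) → i≢j i≡j)))

module IncidenceBound {m ℓ} {A : Pred (Fin n) ℓ₁} (A? : Decidable A)
  {On : Fin n → Fin m → Set ℓ} (On? : ∀ i q → Dec (On i q))
  (covered : ∀ {b x y} → ¬ A b → A x → A y → ¬ x ≡ y →
             Σ (Fin m) λ q → On b q × On x q × On y q)
  (unique : ∀ {x b c q q′} → A x → ¬ A b → ¬ A c → ¬ b ≡ c →
            On x q × On b q × On c q → On x q′ × On b q′ × On c q′ → q ≡ q′)
  (at-most-two : ∀ {q b} → ¬ A b → On b q →
                 ∀ {x y z} → ¬ x ≡ y → ¬ x ≡ z → ¬ y ≡ z →
                 A x × On x q → A y × On y q → A z × On z q → ⊥)
  (π : Fin m) (π-pure : ∀ {b} → ¬ A b → ¬ On b π)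
  where

  B? : Decidable (λ i → ¬ A i)
  B? = ¬? ∘ A?

  private
    module BA = Flags B? A? On?
    module AB = Flags A? B? On?

  α β : Fin m → ℕ
  α q = count (AB.X-on q)
  β q = count (AB.Y-on q)

  on-block : ∀ q → 2 * BA.flags q + 4 * 𝟙 (π ≟ q) ≤ 4 + AB.flags q
  on-block q = subst₂ (λ u v → 2 * u + 4 * 𝟙 (π ≟ q) ≤ 4 + v)
    (sym (BA.flags-on-block q)) (sym (AB.flags-on-block q))
    (block-inequality (α q) (β q) (𝟙 (π ≟ q)) (𝟙-≤1 (π ≟ q)) two-points π-empty)
    where
    two-points : 1 ≤ β q → α q ≤ 2
    two-points β≥1 with 3 ≤? α q
    ... | no α≱3 = s≤s⁻¹ (≰⇒> α≱3)
    ... | yes α≥3 =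
      let b , b∉A , bq = count-witness (AB.Y-on q) β≥1
          x , y , z , x≢y , x≢z , y≢z , xq , yq , zq = three-witnesses (AB.X-on q) α≥3
      in ⊥-elim (at-most-two b∉A bq x≢y x≢z y≢z xq yq zq)
    π-empty : 1 ≤ 𝟙 (π ≟ q) → β q ≡ 0
    π-empty is-π with 𝟙-true (π ≟ q) is-π
    ... | refl = count-none (AB.Y-on π) (λ b (b∉A , bπ) → π-pure b∉A bπ)

  theorem : 4 + 2 * (count B? * (count A? * (count A? ∸ 1))) ≤
            4 * m + count A? * (count B? * (count B? ∸ 1))
  theorem = begin
    4 + 2 * (count B? * (count A? * (count A? ∸ 1)))
      ≤⟨ +-monoʳ-≤ 4 (*-monoʳ-≤ 2 (BA.flags-≥ covered)) ⟩
    4 + 2 * sum BA.flags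
      ≡⟨ +-comm 4 _ ⟩
    2 * sum BA.flags + 4 * 1
      ≡⟨ cong (λ c → 2 * sum BA.flags + 4 * c) (count-singleton π) ⟨
    2 * sum BA.flags + 4 * count (π ≟_)
      ≡⟨ cong₂ _+_ (*-distribˡ-sum 2 BA.flags) (*-distribˡ-sum 4 (λ q → 𝟙 (π ≟ q))) ⟩
    sum (λ q → 2 * BA.flags q) + sum (λ q → 4 * 𝟙 (π ≟ q))
      ≡⟨ ∑-distrib-+ (λ q → 2 * BA.flags q) (λ q → 4 * 𝟙 (π ≟ q)) ⟨
    sum (λ q → 2 * BA.flags q + 4 * 𝟙 (π ≟ q))
      ≤⟨ sum-mono on-block ⟩
    sum (λ q → 4 + AB.flags q)
      ≡⟨ ∑-distrib-+ (λ _ → 4) AB.flags ⟩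
    sum {m} (λ _ → 4) + sum AB.flags
      ≡⟨ cong (_+ sum AB.flags) (trans (sum-const m 4) (*-comm m 4)) ⟩
    4 * m + sum AB.flags
      ≤⟨ +-monoʳ-≤ (4 * m) (AB.flags-≤ (λ x b c → unique x b c)) ⟩
    4 * m + count A? * (count B? * (count B? ∸ 1)) ∎
    where open ≤-Reasoning

no-pairs : ∀ k m c → 1 ≤ m → 4 + 2 * (k * 0) ≤ 4 * m + c
no-pairs k m c m≥1 = begin
  4 + 2 * (k * 0) ≡⟨ cong (λ t → 4 + 2 * t) (*-zeroʳ k) ⟩
  4               ≤⟨ *-monoʳ-≤ 4 m≥1 ⟩
  4 * m           ≤⟨ m≤m+n (4 * m) c ⟩
  4 * m + c       ∎
  where open ≤-Reasoning

small-class-bound : ∀ k a m → a ≤ 2 → 4 ≤ k + a → 1 ≤ m → (k + a ≡ 4 → 2 ≤ m) →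
                    4 + 2 * (k * (a * (a ∸ 1))) ≤ 4 * m + a * (k * (k ∸ 1))
small-class-bound k 0 m _ _ m≥1 _ = no-pairs k m _ m≥1
small-class-bound k 1 m _ _ m≥1 _ = no-pairs k m _ m≥1
small-class-bound 2 2 m _ _ _ n≡4⇒m≥2 = +-monoˡ-≤ 4 (*-monoʳ-≤ 4 (n≡4⇒m≥2 refl))
small-class-bound 3 2 m _ _ m≥1 _ = +-monoˡ-≤ 12 (*-monoʳ-≤ 4 m≥1)
small-class-bound (suc (suc (suc (suc j)))) 2 m _ _ _ _ =
  ≤-trans (≤-trans (m≤m+n _ (4 + 10 * j + 2 * (j * j))) (≤-reflexive (expand j))) (m≤n+m _ (4 * m))
  where
  expand : ∀ j → 4 + 2 * ((4 + j) * 2) + (4 + 10 * j + 2 * (j * j)) ≡ 2 * ((4 + j) * (3 + j))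
  expand = solve-∀
small-class-bound 0 2 m _ (s≤s (s≤s ())) _ _
small-class-bound 1 2 m _ (s≤s (s≤s (s≤s ()))) _ _
small-class-bound k (suc (suc (suc a))) m (s≤s (s≤s ())) _ _ _

double-choose-2 : ∀ x → 2 * (x C 2) ≡ x * (x ∸ 1)
double-choose-2 zero    = refl
double-choose-2 (suc x) = begin
  2 * (suc x C 2)           ≡⟨ cong (2 *_) (nCk+nC[k+1]≡[n+1]C[k+1] x 1) ⟨
  2 * (x C 1 + x C 2)       ≡⟨ cong (λ t → 2 * (t + x C 2)) (nC1≡n x) ⟩
  2 * (x + x C 2)           ≡⟨ *-distribˡ-+ 2 x (x C 2) ⟩
  2 * x + 2 * (x C 2)       ≡⟨ cong (2 * x +_) (double-choose-2 x) ⟩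
  2 * x + x * (x ∸ 1)       ≡⟨ pascal x ⟩
  suc x * x                 ∎
  where
  open ≡-Reasoning
  pascal : ∀ x → 2 * x + x * (x ∸ 1) ≡ suc x * x
  pascal zero    = refl
  pascal (suc x) = expand x
    where
    expand : ∀ x → 2 * suc x + suc x * x ≡ suc (suc x) * suc x
    expand = solve-∀

in-binomials : ∀ k a m → 4 + 2 * (k * (a * (a ∸ 1))) ≤ 4 * m + a * (k * (k ∸ 1)) →
               2 + 2 * (k * (a C 2)) ≤ 2 * m + (k C 2) * a
in-binomials k a m bound = *-cancelˡ-≤ 2 (subst₂ _≤_ (sym lhs) (sym rhs) bound)
  where
  lhs : 2 * (2 + 2 * (k * (a C 2))) ≡ 4 + 2 * (k * (a * (a ∸ 1)))
  lhs = trans (rearrange₁ k (a C 2)) (cong (λ t → 4 + 2 * (k * t)) (double-choose-2 a))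
    where
    rearrange₁ : ∀ k c → 2 * (2 + 2 * (k * c)) ≡ 4 + 2 * (k * (2 * c))
    rearrange₁ = solve-∀
  rhs : 2 * (2 * m + (k C 2) * a) ≡ 4 * m + a * (k * (k ∸ 1))
  rhs = trans (rearrange₂ m (k C 2) a) (cong (λ t → 4 * m + a * t) (double-choose-2 k))
    where
    rearrange₂ : ∀ m c a → 2 * (2 * m + c * a) ≡ 4 * m + a * (2 * c)
    rearrange₂ = solve-∀

_>>=¬¬_ : ¬ ¬ A → (A → ¬ ¬ B) → ¬ ¬ B
(¬¬a >>=¬¬ f) ¬b = ¬¬a (λ x → f x ¬b)

¬¬-finite-choice : ∀ {n} {P : Fin n → Set ℓ₁} → (∀ i → ¬ ¬ P i) → ¬ ¬ (∀ i → P i)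
¬¬-finite-choice {n = zero}  _    ¬all = ¬all (λ ())
¬¬-finite-choice {n = suc n} ¬¬P ¬all =
  ¬¬P zero λ p₀ → ¬¬-finite-choice (¬¬P ∘ suc) λ ps → ¬all λ where
    zero    → p₀
    (suc i) → ps i

count-tail : ∀ {n} s (T : Subset n) → sum (λ i → 𝟙 (suc i ∈? s ∷ T)) ≡ count (_∈? T)
count-tail s T = sum-cong-≗ (λ i → 𝟙-cong (suc i ∈? s ∷ T) (i ∈? T) drop-there there)

count-subset : ∀ {n} (T : Subset n) → count (_∈? T) ≡ ∣ T ∣
count-subset []            = refl
count-subset (inside ∷ T)  = cong suc (trans (count-tail inside T) (count-subset T))
count-subset (outside ∷ T) = trans (count-tail outside T) (count-subset T)

module _ {A : Set ℓ₁} {_~_ : A → A → Set ℓ₂} (~-sym : ∀ {x y} → x ~ y → y ~ x) where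

  no-repetition : ∀ {xs} → AllPairs (λ x y → ¬ x ~ y) xs →
                  ∀ {q q′} → lookup xs q ~ lookup xs q′ → q ≡ q′
  no-repetition (_ ∷ _)  {zero}  {zero}   _ = refl
  no-repetition (px ∷ _) {zero}  {suc q′} r = contradiction r (All.lookup px (∈-lookup q′))
  no-repetition (px ∷ _) {suc q} {zero}   r = contradiction (~-sym r) (All.lookup px (∈-lookup q))
  no-repetition (_ ∷ ps) {suc q} {suc q′} r = cong suc (no-repetition ps r)

fin-positive : ∀ {m} → Fin m → 1 ≤ m
fin-positive {suc _} _ = s≤s z≤n

fin-two : ∀ {m} {q q′ : Fin m} → ¬ q ≡ q′ → 2 ≤ m
fin-two {1}           {zero} {zero} q≢q′ = contradiction refl q≢q′
fin-two {suc (suc _)} _                  = s≤s (s≤s z≤n)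

module Configuration {ℓ : Level} (R : RealField ℓ) where
  open Geometry R
  open RealGeometry R

  Complete : ∀ {n} → (Fin n → Point) → List Plane → Set ℓ
  Complete S Ps = ∀ P → Determined S P → Any (SamePlane P) Ps

  locate : ∀ {n} {S : Fin n → Point} {Ps} → Complete S Ps → ∀ {P} → Determined S P →
           Σ (Fin (length Ps)) λ q → SamePlane P (lookup Ps q)
  locate complete {P} det = Any.index (complete P det) , lookup-index (complete P det)

  SamePlane-sym : ∀ {P Q} → SamePlane P Q → SamePlane Q P
  SamePlane-sym P≈Q v = ⇔.sym (P≈Q v)

  module Points {n : ℕ} (S : Fin n → Point) (distinct : Distinct S) (no-three : NoThreeCollinear S) where

    noncollinear : ∀ {i j k} → ¬ i ≡ j → ¬ i ≡ k → ¬ j ≡ k → ¬ normal-of (S i) (S j) (S k) ≡ 0P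
    noncollinear i≢j i≢k j≢k normal≡0 =
      no-three _ _ _ i≢j i≢k j≢k (collinear _ _ _ (i≢j ∘ distinct _ _) normal≡0)

    coincide : ∀ {i j k} → ¬ i ≡ j → ¬ i ≡ k → ¬ j ≡ k → (P Q : Plane) →
               S i OnPlane P × S j OnPlane P × S k OnPlane P →
               S i OnPlane Q × S j OnPlane Q × S k OnPlane Q → SamePlane P Q
    coincide i≢j i≢k j≢k P Q (iP , jP , kP) (iQ , jQ , kQ) =
      same-plane P Q (noncollinear i≢j i≢k j≢k) iP jP kP iQ jQ kQ

    position-of : ∀ {Ps} → Complete S Ps → ∀ {i j k} → ¬ i ≡ j → ¬ i ≡ k → ¬ j ≡ k →
                  Σ (Fin (length Ps)) λ q → S i OnPlane lookup Ps q × S j OnPlane lookup Ps q × S k OnPlane lookup Ps q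
    position-of complete {i} {j} {k} i≢j i≢k j≢k =
      let P , on-i , on-j , on-k = plane-through (noncollinear i≢j i≢k j≢k)
          q , P≈q = locate complete {P} (i , j , k , i≢j , i≢k , j≢k , on-i , on-j , on-k)
      in q , Equivalence.to (P≈q (S i)) on-i , Equivalence.to (P≈q (S j)) on-j , Equivalence.to (P≈q (S k)) on-k

  -- A non-coplanar set of points with no three collinear has at least four
  -- points: fewer points always lie on a common plane.
  at-least-four : ∀ {n} (S : Fin n → Point) → Distinct S → NoThreeCollinear S → NotAllCoplanar S → ¬ ¬ (4 ≤ n)
  at-least-four {0} S _ _ not-coplanar _ =
    plane-through-two 0P 0P λ (P , _) → not-coplanar (P , λ ())
  at-least-four {1} S _ _ not-coplanar _ =
    plane-through-two (S 0F) (S 0F) λ (P , on₀ , _) → not-coplanar (P , λ { 0F → on₀ })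
  at-least-four {2} S _ _ not-coplanar _ =
    plane-through-two (S 0F) (S 1F) λ (P , on₀ , on₁) → not-coplanar (P , λ { 0F → on₀ ; 1F → on₁ })
  at-least-four {3} S distinct no-three not-coplanar _ =
    let P , on₀ , on₁ , on₂ = plane-through (Points.noncollinear S distinct no-three
                                               {0F} {1F} {2F} (λ ()) (λ ()) (λ ()))
    in not-coplanar (P , λ { 0F → on₀ ; 1F → on₁ ; 2F → on₂ })
  at-least-four {suc (suc (suc (suc _)))} _ _ _ _ ¬4≤n = ¬4≤n (s≤s (s≤s (s≤s (s≤s z≤n))))

  some-plane : ∀ {n} (S : Fin n → Point) → Distinct S → NoThreeCollinear S →
               ∀ Ps → Complete S Ps → 3 ≤ n → 1 ≤ length Ps
  some-plane {suc (suc (suc _))} S distinct no-three Ps complete _ =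
    fin-positive (proj₁ (Points.position-of S distinct no-three complete {0F} {1F} {2F} (λ ()) (λ ()) (λ ())))
  some-plane {0} _ _ _ _ _ ()
  some-plane {1} _ _ _ _ _ (s≤s ())
  some-plane {2} _ _ _ _ _ (s≤s (s≤s ()))

  -- Four non-coplanar points determine at least two planes: the planes
  -- through the points 0, 1, 2 and through 0, 1, 3 differ.
  two-planes : (S : Fin 4 → Point) → Distinct S → NoThreeCollinear S → NotAllCoplanar S →
               ∀ Ps → Complete S Ps → 2 ≤ length Ps
  two-planes S distinct no-three not-coplanar Ps complete =
    let q₁ , on₀ , on₁ , on₂ = position-of complete {0F} {1F} {2F} (λ ()) (λ ()) (λ ())
        q₂ , _ , _ , on₃     = position-of complete {0F} {1F} {3F} (λ ()) (λ ()) (λ ())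
    in fin-two {q = q₁} {q₂} λ q₁≡q₂ → not-coplanar (lookup Ps q₁ , λ where
         0F → on₀
         1F → on₁
         2F → on₂
         3F → subst (λ q → S 3F OnPlane lookup Ps q) (sym q₁≡q₂) on₃)
    where open Points S distinct no-three

  module Bound {n k : ℕ} (S : Fin n → Point) (distinct : Distinct S) (not-coplanar : NotAllCoplanar S)
    (no-three : NoThreeCollinear S) (k≤n : k ≤ n)
    (Π : Plane) (T : Subset n) (|T|≡a : ∣ T ∣ ≡ n ∸ k) (T≈Π : ∀ i → (i ∈ T) ⇔ (S i OnPlane Π))
    (Ps : List Plane) (no-repeats : AllPairs (λ P Q → ¬ SamePlane P Q) Ps) (complete : Complete S Ps)
    where
    open Points S distinct no-three

    a m : ℕ
    a = n ∸ k
    m = length Ps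

    On : Fin n → Fin m → Set ℓ
    On i q = S i OnPlane lookup Ps q

    on-Π : ∀ {i} → i ∈ T → S i OnPlane Π
    on-Π {i} = Equivalence.to (T≈Π i)

    in-T : ∀ {i} → S i OnPlane Π → i ∈ T
    in-T {i} = Equivalence.from (T≈Π i)

    apart : ∀ {i j} → i ∈ T → ¬ j ∈ T → ¬ j ≡ i
    apart i∈T j∉T refl = j∉T i∈T

    same-position : ∀ {q q′} → SamePlane (lookup Ps q) (lookup Ps q′) → q ≡ q′
    same-position = no-repetition (λ {P} {Q} → SamePlane-sym {P} {Q}) no-repeats

    covered : ∀ {b x y} → ¬ b ∈ T → x ∈ T → y ∈ T → ¬ x ≡ y → Σ (Fin m) λ q → On b q × On x q × On y q
    covered b∉T x∈T y∈T x≢y = position-of complete (apart x∈T b∉T) (apart y∈T b∉T) x≢y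

    unique : ∀ {x b c q q′} → x ∈ T → ¬ b ∈ T → ¬ c ∈ T → ¬ b ≡ c →
             On x q × On b q × On c q → On x q′ × On b q′ × On c q′ → q ≡ q′
    unique {q = q} {q′} x∈T b∉T c∉T b≢c (xq , bq , cq) (xq′ , bq′ , cq′) =
      same-position (coincide b≢c (apart x∈T b∉T) (apart x∈T c∉T) (lookup Ps q) (lookup Ps q′)
                              (bq , cq , xq) (bq′ , cq′ , xq′))

    -- A plane through three points of T is Π, so it contains no other point.
    at-most-two : ∀ {q b} → ¬ b ∈ T → On b q →
                  ∀ {x y z} → ¬ x ≡ y → ¬ x ≡ z → ¬ y ≡ z →
                  x ∈ T × On x q → y ∈ T × On y q → z ∈ T × On z q → ⊥
    at-most-two {q} {b} b∉T bq x≢y x≢z y≢z (x∈T , xq) (y∈T , yq) (z∈T , zq) =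
      b∉T (in-T (Equivalence.to (coincide x≢y x≢z y≢z (lookup Ps q) Π (xq , yq , zq)
                                          (on-Π x∈T , on-Π y∈T , on-Π z∈T) (S b)) bq))

    count-T : count (_∈? T) ≡ a
    count-T = trans (count-subset T) |T|≡a

    count-outside : count (¬? ∘ (_∈? T)) ≡ k
    count-outside = begin
      count (¬? ∘ (_∈? T))                              ≡⟨ m+n∸m≡n (count (_∈? T)) _ ⟨
      count (_∈? T) + count (¬? ∘ (_∈? T)) ∸ count (_∈? T) ≡⟨ cong₂ _∸_ (count-complement (_∈? T)) count-T ⟩
      n ∸ (n ∸ k)                                       ≡⟨ m∸[m∸n]≡n k≤n ⟩
      k                                                 ∎
      where open ≡-Reasoning

    Π-block : 3 ≤ a → Σ (Fin m) λ π → ∀ {b} → ¬ b ∈ T → ¬ On b π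
    Π-block a≥3 =
      let x , y , z , x≢y , x≢z , y≢z , x∈T , y∈T , z∈T =
            three-witnesses (_∈? T) (subst (3 ≤_) (sym count-T) a≥3)
          π , Π≈π = locate complete {Π} (x , y , z , x≢y , x≢z , y≢z , on-Π x∈T , on-Π y∈T , on-Π z∈T)
      in π , λ {b} b∉T bπ → b∉T (in-T (Equivalence.from (Π≈π (S b)) bπ))

    bound : (∀ i q → Dec (On i q)) → 4 ≤ n → 4 + 2 * (k * (a * (a ∸ 1))) ≤ 4 * m + a * (k * (k ∸ 1))
    bound On? n≥4 with 3 ≤? a
    ... | yes a≥3 =
      let π , π-pure = Π-block a≥3 in
      subst₂ (λ α κ → 4 + 2 * (κ * (α * (α ∸ 1))) ≤ 4 * m + α * (κ * (κ ∸ 1))) count-T count-outside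
           (IncidenceBound.theorem (_∈? T) On? covered unique at-most-two π π-pure)
    ... | no a≱3 =
      small-class-bound k a m (s≤s⁻¹ (≰⇒> a≱3)) (subst (4 ≤_) (sym k+a≡n) n≥4)
        (some-plane S distinct no-three Ps complete (≤-trans (s≤s (s≤s (s≤s z≤n))) n≥4))
        (four-points ∘ trans (sym k+a≡n))
      where
      k+a≡n : k + a ≡ n
      k+a≡n = m+[n∸m]≡n k≤n
      four-points : n ≡ 4 → 2 ≤ m
      four-points refl = two-planes S distinct no-three not-coplanar Ps complete

lemma6 : ∀ {ℓ : Level} (R : RealField ℓ) → let open Geometry R in
         (n k : ℕ) (S : Fin n → Point) →
         Distinct S → NotAllCoplanar S → NoThreeCollinear S →
         1 ≤ k → k ≤ n →
         Σ Plane (λ P → ContainsExactly S P (n ∸ k)) →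
         (Ps : List Plane) → ListsDeterminedPlanes S Ps →
         2 + 2 * (k * ((n ∸ k) C 2)) ≤ 2 * length Ps + (k C 2) * (n ∸ k)
lemma6 R n k S distinct not-coplanar no-three _ k≤n (Π , T , |T|≡ , T≈Π) Ps (_ , no-repeats , complete) =
  -- The goal is a decidable inequality, so it suffices to prove it under
  -- double negation; this gives decidability of incidence between the points
  -- and the listed planes.
  decidable-stable (_ ≤? _) (
    at-least-four S distinct no-three not-coplanar >>=¬¬ λ n≥4 →
    ¬¬-map (λ On? → in-binomials k (n ∸ k) (length Ps) (Config.bound On? n≥4)) incidence-decidable)
  where
  open Configuration R using (at-least-four)
  module Config = Configuration.Bound R S distinct not-coplanar no-three k≤n Π T |T|≡ T≈Π Ps no-repeats complete
  incidence-decidable : ¬ ¬ (∀ i q → Dec (Config.On i q))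
  incidence-decidable = ¬¬-finite-choice λ i → ¬¬-finite-choice λ q → ¬¬-excluded-middle
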